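{- Let $\mathcal N$ be a phylogenetic network on $X$ and let $A\subseteq X$. Let $v$ be a tree vertex of $\mathcal N$ with children $c_1$ and $c_2$, and suppose there exist $\ell_1,\ell_2\in A$ such that (i) $\ell_1$ is a descendant of $c_1$, (ii) $\ell_2$ is a descendant of $c_2$, and (iii) $\ell_2$ is not a descendant of $c_1$. Then $v$ is a vertex of $\mathcal N_A$.
   Context: All paths are directed. A (binary) phylogenetic network $\mathcal N$ on a non-empty finite set $X$ is a rooted acyclic directed graph with no parallel arcs such that: the unique root has in-degree 0 and out-degree 2; the set of vertices of out-degree 0 is $X$ (the leaves), each of in-degree 1; every other vertex has either in-degree 1 and out-degree 2 (tree vertex) or in-degree 2 and out-degree 1 (reticulation). If $|X|=1$, $\mathcal N$ may also be the single vertex of $X$. $v$ is a descendant of $u$ if there is a path from $u$ to $v$ (every vertex is a descendant of itself). A stable ancestor of $X'\subseteq X$ is a vertex $u$ such that for every $x\in X'$ every path from the root to $x$ traverses $u$; ${\rm lsa}(X')$ is the unique stable ancestor of $X'$ with no other stable ancestor of $X'$ as a descendant. The path graph of $\mathcal N$ on $A$ is the subgraph consisting of all vertices and arcs on paths from ${\rm lsa}(A)$ to leaves in $A$. The full simplification of a directed graph is obtained by repeatedly suppressing vertices of in-degree one and out-degree one and deleting exactly one arc of any pair of parallel arcs until neither applies; $\mathcal N_A$ (the network exhibited by $\mathcal N$ on $A$) is the full simplification of the path graph, so its vertices form a subset of the vertices of $\mathcal N$. -}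

module Defs where

open import Data.Nat using (ℕ; zero; suc)
open import Data.Fin using (Fin) renaming (_≟_ to _≟ᶠ_)
open import Data.Product using (Σ; ∃; ∃-syntax; _×_; _,_; proj₁; proj₂)
open import Data.Sum using (_⊎_)
open import Data.List using (List; []; _∷_; length; filterᵇ)
open import Data.List.Membership.Propositional using (_∈_)
open import Data.List.Relation.Unary.All using (All)
open import Data.List.Relation.Unary.Unique.Propositional using (Unique)
open import Data.List.Relation.Binary.Permutation.Propositional using (_↭_)
open import Relation.Binary.PropositionalEquality using (_≡_; _≢_)
open import Relation.Binary.Construct.Closure.ReflexiveTransitive using (Star)
open import Relation.Nullary using (¬_; does)
open import Function.Bundles using (_⇔_)

Arc : ℕ → Set
Arc n = Fin n × Fin n

-- Directed (multi)graphs on a subset of the vertex set Fin n: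
-- a vertex predicate and a list (multiset) of arcs.

record Graph (n : ℕ) : Set₁ where
  field
    vs : Fin n → Set
    es : List (Arc n)
open Graph public

indeg : ∀ {n} → List (Arc n) → Fin n → ℕ
indeg es v = length (filterᵇ (λ e → does (proj₂ e ≟ᶠ v)) es)

outdeg : ∀ {n} → List (Arc n) → Fin n → ℕ
outdeg es v = length (filterᵇ (λ e → does (proj₁ e ≟ᶠ v)) es)

data Path {n : ℕ} (es : List (Arc n)) : Fin n → Fin n → Set where
  []  : ∀ {u} → Path es u u
  _∷_ : ∀ {u w x} → (u , w) ∈ es → Path es w x → Path es u x

data Traverses {n : ℕ} {es : List (Arc n)} (t : Fin n) :
       ∀ {u x} → Path es u x → Set where
  here-end : Traverses t {t} {t} []
  here     : ∀ {w x} (a : (t , w) ∈ es) (p : Path es w x) → Traverses t (a ∷ p)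
  there    : ∀ {u w x} (a : (u , w) ∈ es) {p : Path es w x} →
             Traverses t p → Traverses t (a ∷ p)

record Network (n : ℕ) : Set where
  field
    arcs : List (Arc n)
    root : Fin n

  IsLeaf : Fin n → Set
  IsLeaf v = outdeg arcs v ≡ 0

  IsTreeVertex : Fin n → Set
  IsTreeVertex v = indeg arcs v ≡ 1 × outdeg arcs v ≡ 2

  IsReticulation : Fin n → Set
  IsReticulation v = indeg arcs v ≡ 2 × outdeg arcs v ≡ 1

  IsDescendant : Fin n → Fin n → Set
  IsDescendant v u = Path arcs u v

  field
    noParallel : Unique arcs
    acyclic    : ∀ {u w} → (u , w) ∈ arcs → ¬ Path arcs w u
    shape      :
      -- the single-vertex network (|X| = 1)
      (n ≡ 1 × arcs ≡ [])
      ⊎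
      ( (indeg arcs root ≡ 0 × outdeg arcs root ≡ 2)
      × (∀ v → v ≢ root →
           (indeg arcs v ≡ 1 × outdeg arcs v ≡ 0)
           ⊎ IsTreeVertex v ⊎ IsReticulation v))

open Network public

module _ {n : ℕ} (N : Network n) where

  IsStableAncestor : (Fin n → Set) → Fin n → Set
  IsStableAncestor A u =
    ∀ x → A x → (p : Path (arcs N) (root N) x) → Traverses u p

  IsLSA : (Fin n → Set) → Fin n → Set
  IsLSA A u = IsStableAncestor A u
            × (∀ w → IsStableAncestor A w → IsDescendant N w u → w ≡ u)

  IsPathGraph : (Fin n → Set) → Fin n → Graph n → Set
  IsPathGraph A a G =
      (∀ w → vs G w ⇔ (Path (arcs N) a w × ∃[ x ] (A x × Path (arcs N) w x)))
    × (∀ u w → (u , w) ∈ es G ⇔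
         ((u , w) ∈ arcs N × Path (arcs N) a u × ∃[ x ] (A x × Path (arcs N) w x)))
    × Unique (es G)

data SimpStep {n : ℕ} : Graph n → Graph n → Set₁ where
  suppress : ∀ (G : Graph n) (w u x : Fin n) (rest : List (Arc n)) →
    vs G w →
    es G ↭ ((u , w) ∷ (w , x) ∷ rest) →
    All (λ e → proj₁ e ≢ w × proj₂ e ≢ w) rest →
    SimpStep G (record { vs = λ y → y ≢ w × vs G y ; es = (u , x) ∷ rest })
  deleteParallel : ∀ (G : Graph n) (u x : Fin n) (rest : List (Arc n)) →
    es G ↭ ((u , x) ∷ (u , x) ∷ rest) →
    SimpStep G (record { vs = vs G ; es = (u , x) ∷ rest })

IsFullSimplification : ∀ {n} → Graph n → Graph n → Set₁
IsFullSimplification G H = Star SimpStep G H × (∀ H' → ¬ SimpStep H H')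

-- Since lsa(A) lies above v, the path graph contains both arcs v → c₁ and v → c₂, with ℓ₂
-- reachable from c₂ but not from c₁. Along the simplification every arc stands for a nonempty
-- path of N, and v keeps two out-arcs: one from which ℓ₂ is reachable in the current graph and
-- one from which ℓ₂ is unreachable in N. These cannot end in the same vertex, whereas a
-- suppressed vertex has a single out-neighbour; so v is never suppressed.
module Submission where

open import Defs
open import Data.Nat using (ℕ; zero; suc; _≤_; _<_; s≤s)
open import Data.Nat.Properties using (_<?_; ≮⇒≥; <-irrefl)
open import Data.Fin using (Fin; toℕ) renaming (_≟_ to _≟ᶠ_)
open import Data.Fin.Properties using (pigeonhole; toℕ≤pred[n])
open import Data.Product using (Σ-syntax; ∃-syntax; _×_; _,_; proj₁; proj₂)
open import Data.Sum using (_⊎_; inj₁; inj₂)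
open import Data.Empty using (⊥-elim)
open import Data.List using (List; []; _∷_; length; filterᵇ)
open import Data.List.Membership.Propositional using (_∈_; _∉_)
open import Data.List.Membership.Propositional.Properties using (∈-filter⁺; ∈-filter⁻)
open import Data.List.Relation.Unary.Any using (here; there)
open import Data.List.Relation.Unary.All using (All; lookup)
open import Data.List.Relation.Binary.Permutation.Propositional using (_↭_; ↭-sym)
open import Data.List.Relation.Binary.Permutation.Propositional.Properties using (∈-resp-↭)
open import Relation.Binary.Construct.Closure.ReflexiveTransitive using (Star; ε; _◅_)
open import Relation.Binary.PropositionalEquality using (_≡_; _≢_; refl; sym; trans; subst)
open import Relation.Nullary using (¬_; Dec; yes; no; does)
open import Data.Bool using (T)
open import Function using (_∘_)
open import Function.Bundles using (Equivalence)

variable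
  n : ℕ
  s t u w x y z : Fin n
  E E₁ E₂ rest : List (Arc n)

infixr 5 _++ᵖ_

_++ᵖ_ : Path E s t → Path E t u → Path E s u
[] ++ᵖ q = q
(e ∷ p) ++ᵖ q = e ∷ (p ++ᵖ q)

Path-map : (∀ {e} → e ∈ E₁ → e ∈ E₂) → Path E₁ s t → Path E₂ s t
Path-map f [] = []
Path-map f (e ∷ p) = f e ∷ Path-map f p

Path⁺ : List (Arc n) → Fin n → Fin n → Set
Path⁺ E s t = ∃[ m ] ((s , m) ∈ E × Path E m t)

Path⁺⇒Path : Path⁺ E s t → Path E s t
Path⁺⇒Path (_ , e , p) = e ∷ p

pathLength : Path E s t → ℕ
pathLength [] = 0
pathLength (_ ∷ p) = suc (pathLength p)

traverses-++ : (p : Path E s t) (q : Path E t u) →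
               Traverses z (p ++ᵖ q) → Traverses z p ⊎ Traverses z q
traverses-++ [] q tr = inj₂ tr
traverses-++ (e ∷ p) q (here .e .(p ++ᵖ q)) = inj₁ (here e p)
traverses-++ (e ∷ p) q (there .e tr) with traverses-++ p q tr
... | inj₁ trp = inj₁ (there e trp)
... | inj₂ trq = inj₂ trq

path-to-traversed : {p : Path E s t} → Traverses z p → Path E s z
path-to-traversed here-end = []
path-to-traversed (here e p) = []
path-to-traversed (there e tr) = e ∷ path-to-traversed tr

path-from-traversed : {p : Path E s t} → Traverses z p → Path E z t
path-from-traversed here-end = []
path-from-traversed (here e p) = e ∷ p
path-from-traversed (there e tr) = path-from-traversed tr

Acyclic : List (Arc n) → Set
Acyclic E = ∀ {u w} → (u , w) ∈ E → ¬ Path E w u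

vertexAt : ∀ {n} {E : List (Arc n)} {s t} → Path E s t → ℕ → Fin n
vertexAt {s = s} p zero = s
vertexAt {t = t} [] (suc i) = t
vertexAt (_ ∷ p) (suc i) = vertexAt p i

take : (p : Path E s t) (j : ℕ) → j ≤ pathLength p → Path E s (vertexAt p j)
take p zero _ = []
take (e ∷ p) (suc j) (s≤s j≤) = e ∷ take p j j≤

acyclic⇒vertexAt-injective : Acyclic E → (p : Path E s t) {i j : ℕ} →
  i < j → j ≤ pathLength p → vertexAt p i ≢ vertexAt p j
acyclic⇒vertexAt-injective ac (e ∷ p) {zero} {suc j} _ (s≤s j≤) eq =
  ac e (subst (Path _ _) (sym eq) (take p j j≤))
acyclic⇒vertexAt-injective ac (e ∷ p) {suc i} {suc j} (s≤s i<j) (s≤s j≤) =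
  acyclic⇒vertexAt-injective ac p i<j j≤

acyclic⇒pathLength< : ∀ {n} {E : List (Arc n)} {s t} → Acyclic E →
                      (p : Path E s t) → pathLength p < n
acyclic⇒pathLength< {n = n} ac p with pathLength p <? n
... | yes p< = p<
... | no p≮ with pigeonhole (s≤s (≮⇒≥ p≮)) (vertexAt p ∘ toℕ)
...   | i , j , i<j , eq =
  ⊥-elim (acyclic⇒vertexAt-injective ac p i<j (toℕ≤pred[n] j) eq)

-- Walking backwards along in-arcs must reach a, since acyclic paths have fewer than n arcs.
acyclic⇒root-reaches : ∀ {n} {E : List (Arc n)} {a} → Acyclic E →
                       (∀ z → z ≢ a → ∃[ u ] ((u , z) ∈ E)) → ∀ y → Path E a y
acyclic⇒root-reaches {n = n} {E = E} {a = a} ac parent y with walk n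
  where
    walk : ∀ k → Path E a y ⊎ (∃[ z ] Σ[ p ∈ Path E z y ] pathLength p ≡ k)
    walk zero = inj₂ (y , [] , refl)
    walk (suc k) with walk k
    ... | inj₁ p = inj₁ p
    ... | inj₂ (z , p , refl) with z ≟ᶠ a
    ...   | yes refl = inj₁ p
    ...   | no z≢a = let (u , e) = parent z z≢a in inj₂ (u , e ∷ p , refl)
... | inj₁ p = p
... | inj₂ (_ , p , len≡n) = ⊥-elim (<-irrefl len≡n (acyclic⇒pathLength< ac p))

length≢0⇒nonempty : {A : Set} {xs : List A} → length xs ≢ 0 → ∃[ x ] (x ∈ xs)
length≢0⇒nonempty {xs = []} h = ⊥-elim (h refl)
length≢0⇒nonempty {xs = x ∷ _} _ = x , here refl

∈⇒length≢0 : {A : Set} {x : A} {xs : List A} → x ∈ xs → length xs ≢ 0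
∈⇒length≢0 (here _) ()
∈⇒length≢0 (there _) ()

does-sound : {A : Set} (a? : Dec A) → T (does a?) → A
does-sound (yes a) _ = a

does-complete : {A : Set} (a? : Dec A) → A → T (does a?)
does-complete (yes _) _ = _
does-complete (no ¬a) a = ¬a a

indeg≢0⇒in-arc : indeg E z ≢ 0 → ∃[ u ] ((u , z) ∈ E)
indeg≢0⇒in-arc {E = E} {z = z} h
  with length≢0⇒nonempty {xs = filterᵇ (λ e → does (proj₂ e ≟ᶠ z)) E} h
... | (u , z′) , e∈ with ∈-filter⁻ _ e∈
...   | e , is-z with does-sound (z′ ≟ᶠ z) is-z
...     | refl = u , e

outdeg≡0⇒no-out-arc : outdeg E z ≡ 0 → (z , y) ∉ E
outdeg≡0⇒no-out-arc {z = z} h e =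
  ∈⇒length≢0 (∈-filter⁺ _ e (does-complete (z ≟ᶠ z) refl)) h

Avoids : Fin n → Arc n → Set
Avoids w (a , b) = a ≢ w × b ≢ w

mutual
  bypass : All (Avoids w) rest → t ≢ w → s ≢ w →
           Path ((u , w) ∷ (w , x) ∷ rest) s t → Path ((u , x) ∷ rest) s t
  bypass avoid t≢w s≢w [] = []
  bypass avoid t≢w s≢w (here refl ∷ p) = here refl ∷ bypass-from avoid t≢w p
  bypass avoid t≢w s≢w (there (here refl) ∷ p) = ⊥-elim (s≢w refl)
  bypass avoid t≢w s≢w (there (there e) ∷ p) =
    there e ∷ bypass avoid t≢w (proj₂ (lookup avoid e)) p

  bypass-from : All (Avoids w) rest → t ≢ w →
                Path ((u , w) ∷ (w , x) ∷ rest) w t → Path ((u , x) ∷ rest) x t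
  bypass-from avoid t≢w [] = ⊥-elim (t≢w refl)
  bypass-from avoid t≢w (here refl ∷ p) = bypass-from avoid t≢w p
  bypass-from {w = w} {x = x} avoid t≢w (there (here refl) ∷ p) with x ≟ᶠ w
  ... | yes refl = bypass-from avoid t≢w p
  ... | no x≢w = bypass avoid t≢w x≢w p
  bypass-from avoid t≢w (there (there e) ∷ p) = ⊥-elim (proj₁ (lookup avoid e) refl)

Refines : List (Arc n) → List (Arc n) → Set
Refines E L = ∀ {a b} → (a , b) ∈ L → Path⁺ E a b

refines-path : ∀ {n} {E L : List (Arc n)} {s t} → Refines E L → Path L s t → Path E s t
refines-path R [] = []
refines-path R (e ∷ p) = Path⁺⇒Path (R e) ++ᵖ refines-path R p

suppress-refines : ∀ {n} {E L : List (Arc n)} {u w x rest} →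
  L ↭ (u , w) ∷ (w , x) ∷ rest → Refines E L → Refines E ((u , x) ∷ rest)
suppress-refines π R (here refl) =
  let (m , e , p) = R (∈-resp-↭ (↭-sym π) (here refl))
  in m , e , p ++ᵖ Path⁺⇒Path (R (∈-resp-↭ (↭-sym π) (there (here refl))))
suppress-refines π R (there e) = R (∈-resp-↭ (↭-sym π) (there (there e)))

record Separated (E : List (Arc n)) (v t : Fin n) (G : Graph n) : Set where
  field
    refines : Refines E (es G)
    kept : vs G v
    towards away : Fin n
    v→towards : (v , towards) ∈ es G
    v→away : (v , away) ∈ es G
    towards⇝t : Path (es G) towards t
    away↛t : ¬ Path E away t

module _ {n} {E : List (Arc n)} (acyclic : Acyclic E) {v t : Fin n}
         (t-sink : ∀ {y} → (t , y) ∉ E) where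

  refines-irreflexive : ∀ {L a} → Refines E L → (a , a) ∉ L
  refines-irreflexive R e = let (_ , e′ , p) = R e in acyclic e′ p

  refines-source≢t : ∀ {L s y} → Refines E L → (s , y) ∈ L → s ≢ t
  refines-source≢t R e refl = t-sink (proj₁ (proj₂ (R e)))

  suppressed-out-arc : ∀ {L : List (Arc n)} {u w x rest d} → Refines E L →
    L ↭ (u , w) ∷ (w , x) ∷ rest → All (Avoids w) rest → (w , d) ∈ L → d ≡ x
  suppressed-out-arc R π avoid e with ∈-resp-↭ π e
  ... | here refl = ⊥-elim (refines-irreflexive R e)
  ... | there (here refl) = refl
  ... | there (there e′) = ⊥-elim (proj₁ (lookup avoid e′) refl)

  suppressed≢v : ∀ {G : Graph n} {u w x rest} → es G ↭ (u , w) ∷ (w , x) ∷ rest →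
    All (Avoids w) rest → Separated E v t G → v ≢ w
  suppressed≢v π avoid S refl = away↛t (subst (λ d → Path E d t) towards≡away
                                               (refines-path refines towards⇝t))
    where
      open Separated S
      towards≡away : towards ≡ away
      towards≡away = trans (suppressed-out-arc refines π avoid v→towards)
                           (sym (suppressed-out-arc refines π avoid v→away))

  t≢suppressed : ∀ {L : List (Arc n)} {u w x rest} → Refines E L →
    L ↭ (u , w) ∷ (w , x) ∷ rest → t ≢ w
  t≢suppressed R π = refines-source≢t R (∈-resp-↭ (↭-sym π) (there (here refl))) ∘ sym

  suppress-redirect : ∀ {L : List (Arc n)} {u w x rest d} → Refines E L →
    L ↭ (u , w) ∷ (w , x) ∷ rest → All (Avoids w) rest → v ≢ w → (v , d) ∈ L →
    ∃[ d′ ] ((v , d′) ∈ (u , x) ∷ rest × Path E d d′ ×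
             (Path L d t → Path ((u , x) ∷ rest) d′ t))
  suppress-redirect {L = L} {w = w} {x = x} R π avoid v≢w e with ∈-resp-↭ π e
  ... | here refl = x , here refl , Path⁺⇒Path (R w→x) ,
                    bypass-from avoid (t≢suppressed R π) ∘ Path-map (∈-resp-↭ π)
    where
      w→x : (w , x) ∈ L
      w→x = ∈-resp-↭ (↭-sym π) (there (here refl))
  ... | there (here refl) = ⊥-elim (v≢w refl)
  ... | there (there e′) =
    _ , there e′ , [] ,
    bypass avoid (t≢suppressed R π) (proj₂ (lookup avoid e′)) ∘ Path-map (∈-resp-↭ π)

  suppress-separated : ∀ {G : Graph n} {u w x rest} →
    es G ↭ (u , w) ∷ (w , x) ∷ rest → All (Avoids w) rest → Separated E v t G →
    Separated E v t (record { vs = λ y → y ≢ w × vs G y ; es = (u , x) ∷ rest })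
  suppress-separated π avoid S =
    let open Separated S
        v≢w = suppressed≢v π avoid S
        (towards′ , v→towards′ , _ , reroute) =
          suppress-redirect refines π avoid v≢w v→towards
        (away′ , v→away′ , away⇝away′ , _) =
          suppress-redirect refines π avoid v≢w v→away
    in record
      { refines = suppress-refines π refines
      ; kept = v≢w , kept
      ; towards = towards′
      ; away = away′
      ; v→towards = v→towards′
      ; v→away = v→away′
      ; towards⇝t = reroute towards⇝t
      ; away↛t = away↛t ∘ (away⇝away′ ++ᵖ_)
      }

  deleteParallel-separated : ∀ {G : Graph n} {u x rest} →
    es G ↭ (u , x) ∷ (u , x) ∷ rest → Separated E v t G →
    Separated E v t (record { vs = vs G ; es = (u , x) ∷ rest })
  deleteParallel-separated {G = G} {u} {x} {rest} π S = record
    { refines = refines ∘ restore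
    ; kept = kept
    ; towards = towards
    ; away = away
    ; v→towards = merge v→towards
    ; v→away = merge v→away
    ; towards⇝t = Path-map merge towards⇝t
    ; away↛t = away↛t
    }
    where
      open Separated S
      merge : ∀ {e} → e ∈ es G → e ∈ (u , x) ∷ rest
      merge e with ∈-resp-↭ π e
      ... | here eq = here eq
      ... | there e′ = e′
      restore : ∀ {e} → e ∈ (u , x) ∷ rest → e ∈ es G
      restore = ∈-resp-↭ (↭-sym π) ∘ there

  simplification-separated : ∀ {G H : Graph n} → Star SimpStep G H →
                             Separated E v t G → Separated E v t H
  simplification-separated ε = λ S → S
  simplification-separated (suppress _ _ _ _ _ _ π avoid ◅ steps) =
    simplification-separated steps ∘ suppress-separated π avoid
  simplification-separated (deleteParallel _ _ _ _ π ◅ steps) =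
    simplification-separated steps ∘ deleteParallel-separated π

≡suc⇒≢0 : ∀ {k m} → k ≡ suc m → k ≢ 0
≡suc⇒≢0 refl ()

root-reaches : ∀ {n} (N : Network n) y → Path (arcs N) (root N) y
root-reaches N y with shape N
... | inj₁ (refl , _) = singleton-path (root N) y
  where
    singleton-path : ∀ {E : List (Arc 1)} (a b : Fin 1) → Path E a b
    singleton-path Fin.zero Fin.zero = []
... | inj₂ (_ , classify) = acyclic⇒root-reaches (acyclic N) parent y
  where
    parent : ∀ z → z ≢ root N → ∃[ u ] ((u , z) ∈ arcs N)
    parent z z≢root with classify z z≢root
    ... | inj₁ (in1 , _) = indeg≢0⇒in-arc (≡suc⇒≢0 in1)
    ... | inj₂ (inj₁ (in1 , _)) = indeg≢0⇒in-arc (≡suc⇒≢0 in1)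
    ... | inj₂ (inj₂ (in2 , _)) = indeg≢0⇒in-arc (≡suc⇒≢0 in2)

-- The stable ancestor lies on both root paths through v; below v on both, it would
-- sit below c₁ and above ℓ₂.
stable-ancestor-reaches : ∀ {n} (N : Network n) {A : Fin n → Set} {a v c₁ c₂ ℓ₁ ℓ₂} →
  IsStableAncestor N A a → (v , c₁) ∈ arcs N → (v , c₂) ∈ arcs N → A ℓ₁ → A ℓ₂ →
  IsDescendant N ℓ₁ c₁ → IsDescendant N ℓ₂ c₂ → ¬ IsDescendant N ℓ₂ c₁ →
  Path (arcs N) a v
stable-ancestor-reaches N {v = v} {ℓ₁ = ℓ₁} {ℓ₂} stable v→c₁ v→c₂ Aℓ₁ Aℓ₂ c₁⇝ℓ₁ c₂⇝ℓ₂ c₁↛ℓ₂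
  with traverses-++ root⇝v (v→c₁ ∷ c₁⇝ℓ₁) (stable ℓ₁ Aℓ₁ (root⇝v ++ᵖ v→c₁ ∷ c₁⇝ℓ₁))
     | traverses-++ root⇝v (v→c₂ ∷ c₂⇝ℓ₂) (stable ℓ₂ Aℓ₂ (root⇝v ++ᵖ v→c₂ ∷ c₂⇝ℓ₂))
  where
    root⇝v : Path (arcs N) (root N) v
    root⇝v = root-reaches N v
... | inj₁ above-v | _ = path-from-traversed above-v
... | _ | inj₁ above-v = path-from-traversed above-v
... | inj₂ (here _ _) | _ = []
... | _ | inj₂ (here _ _) = []
... | inj₂ (there _ below-c₁) | inj₂ (there _ below-c₂) =
  ⊥-elim (c₁↛ℓ₂ (path-to-traversed below-c₁ ++ᵖ path-from-traversed below-c₂))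

pathGraph-path : ∀ {n} (N : Network n) {A : Fin n → Set} {a s t} {P : Graph n} →
  IsPathGraph N A a P → A t → Path (arcs N) a s → Path (arcs N) s t → Path (es P) s t
pathGraph-path N _ _ _ [] = []
pathGraph-path N PG@(_ , arc⇔ , _) At a⇝s (e ∷ p) =
  Equivalence.from (arc⇔ _ _) (e , a⇝s , _ , At , p) ∷ pathGraph-path N PG At (a⇝s ++ᵖ e ∷ []) p

pathGraph-refines : ∀ {n} (N : Network n) {A : Fin n → Set} {a} {P : Graph n} →
  IsPathGraph N A a P → Refines (arcs N) (es P)
pathGraph-refines N (_ , arc⇔ , _) {_} {w} e = w , proj₁ (Equivalence.to (arc⇔ _ _) e) , []

pathGraph-separated : ∀ {n} (N : Network n) {A : Fin n → Set} {a v c₁ c₂ ℓ₁ ℓ₂} {P : Graph n} →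
  IsPathGraph N A a P → Path (arcs N) a v →
  (v , c₁) ∈ arcs N → (v , c₂) ∈ arcs N → A ℓ₁ → A ℓ₂ →
  IsDescendant N ℓ₁ c₁ → IsDescendant N ℓ₂ c₂ → ¬ IsDescendant N ℓ₂ c₁ →
  Separated (arcs N) v ℓ₂ P
pathGraph-separated N {v = v} {c₁} {c₂} {ℓ₁} {ℓ₂} PG@(vertex⇔ , arc⇔ , _)
                    a⇝v v→c₁ v→c₂ Aℓ₁ Aℓ₂ c₁⇝ℓ₁ c₂⇝ℓ₂ c₁↛ℓ₂ = record
  { refines = pathGraph-refines N PG
  ; kept = Equivalence.from (vertex⇔ v) (a⇝v , ℓ₂ , Aℓ₂ , v→c₂ ∷ c₂⇝ℓ₂)
  ; towards = c₂
  ; away = c₁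
  ; v→towards = Equivalence.from (arc⇔ v c₂) (v→c₂ , a⇝v , ℓ₂ , Aℓ₂ , c₂⇝ℓ₂)
  ; v→away = Equivalence.from (arc⇔ v c₁) (v→c₁ , a⇝v , ℓ₁ , Aℓ₁ , c₁⇝ℓ₁)
  ; towards⇝t = pathGraph-path N PG Aℓ₂ (a⇝v ++ᵖ v→c₂ ∷ []) c₂⇝ℓ₂
  ; away↛t = c₁↛ℓ₂
  }

lemma2p3 : ∀ {n} (N : Network n) (A : Fin n → Set) →
    (∀ x → A x → IsLeaf N x) →
    ∀ (v c₁ c₂ ℓ₁ ℓ₂ : Fin n) →
    IsTreeVertex N v → (v , c₁) ∈ arcs N → (v , c₂) ∈ arcs N → c₁ ≢ c₂ →
    A ℓ₁ → A ℓ₂ →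
    IsDescendant N ℓ₁ c₁ → IsDescendant N ℓ₂ c₂ → ¬ IsDescendant N ℓ₂ c₁ →
    ∀ (a : Fin n) (P H : Graph n) →
    IsLSA N A a → IsPathGraph N A a P → IsFullSimplification P H →
    vs H v
lemma2p3 N A leaf v c₁ c₂ ℓ₁ ℓ₂ _ v→c₁ v→c₂ _ Aℓ₁ Aℓ₂ c₁⇝ℓ₁ c₂⇝ℓ₂ c₁↛ℓ₂ a P H
         (stable , _) pathGraph (simplifies , _) =
  Separated.kept (simplification-separated (acyclic N) ℓ₂-sink simplifies separatedP)
  where
    a⇝v : Path (arcs N) a v
    a⇝v = stable-ancestor-reaches N stable v→c₁ v→c₂ Aℓ₁ Aℓ₂ c₁⇝ℓ₁ c₂⇝ℓ₂ c₁↛ℓ₂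
    ℓ₂-sink : ∀ {y} → (ℓ₂ , y) ∉ arcs N
    ℓ₂-sink = outdeg≡0⇒no-out-arc (leaf ℓ₂ Aℓ₂)
    separatedP : Separated (arcs N) v ℓ₂ P
    separatedP = pathGraph-separated N pathGraph a⇝v v→c₁ v→c₂ Aℓ₁ Aℓ₂ c₁⇝ℓ₁ c₂⇝ℓ₂ c₁↛ℓ₂
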